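{- Let $P,Q$ be finite thin posets, each with a unique minimal and a unique maximal element, of equal rank $n\ge 3$. Then the pinch product $P\mathbin{\bowtie}Q$ is a thin poset that is not diamond transitive.
   Context: A graded poset (rank function $\mathrm{rk}$ with $\mathrm{rk}(y)=\mathrm{rk}(x)+1$ for covers) is thin if every nonempty closed interval of length 2 has exactly 4 elements (a diamond). Diamond transitive: for all $x\le y$, any two saturated chains $x=x_0\lessdot\dots\lessdot x_k=y$ are related by finitely many diamond moves, where for a diamond $\{x,a,b,y\}$ a move replaces a subchain $x\lessdot a\lessdot y$ by $x\lessdot b\lessdot y$ or vice versa. Pinch product: $P\mathbin{\bowtie}Q=(P\setminus\{\hat0_P,\hat1_P\})\sqcup(Q\setminus\{\hat0_Q,\hat1_Q\})\sqcup\{\hat0,\hat1\}$ with $x\le y$ iff $x=\hat0$, or $y=\hat1$, or $x,y$ both lie in $P\setminus\{\hat0_P,\hat1_P\}$ with $x\le_P y$, or both lie in $Q\setminus\{\hat0_Q,\hat1_Q\}$ with $x\le_Q y$. -}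

module Defs where

open import Data.Nat using (ℕ; suc; _+_)
open import Data.Fin using (Fin)
open import Data.List using (List; []; _∷_; length)
open import Data.List.Membership.Propositional using (_∈_)
open import Data.List.Relation.Unary.Unique.Propositional using (Unique)
open import Data.Product using (Σ; _×_; _,_; ∃-syntax)
open import Data.Sum using (_⊎_)
open import Data.Unit renaming (⊤ to Unit)
open import Data.Empty renaming (⊥ to Empty)
open import Relation.Nullary using (¬_)
open import Relation.Binary.PropositionalEquality using (_≡_; _≢_)
open import Relation.Binary.Structures using (IsPartialOrder)
open import Relation.Binary.Construct.Closure.ReflexiveTransitive using (Star)
open import Function.Bundles using (_↔_; _⇔_)

module Order {A : Set} (_≤_ : A → A → Set) where

  _<_ : A → A → Set
  x < y = x ≤ y × x ≢ y

  _⋖_ : A → A → Set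
  x ⋖ y = x < y × (∀ z → x < z → ¬ (z < y))

  IsRankFunction : (A → ℕ) → Set
  IsRankFunction rk = ∀ x y → x ⋖ y → rk y ≡ suc (rk x)

  HasFourElements : (A → Set) → Set
  HasFourElements S =
    Σ (List A) λ xs → length xs ≡ 4 × Unique xs × (∀ z → S z ⇔ (z ∈ xs))

  Interval : A → A → A → Set
  Interval x y z = x ≤ z × z ≤ y

  IsThin : (A → ℕ) → Set
  IsThin rk = IsRankFunction rk
    × (∀ x y → x ≤ y → rk y ≡ 2 + rk x → HasFourElements (Interval x y))

  Diamond : A → A → A → A → Set
  Diamond x a b y = x ⋖ a × a ⋖ y × x ⋖ b × b ⋖ y × a ≢ b
    × (∀ z → Interval x y z → z ≡ x ⊎ z ≡ a ⊎ z ≡ b ⊎ z ≡ y)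

  -- saturated chains, given as their full list of vertices
  -- x = x₀ ⋖ x₁ ⋖ ⋯ ⋖ x_k = y
  data SatChain : A → A → List A → Set where
    single : ∀ {x} → SatChain x x (x ∷ [])
    step   : ∀ {x z y l} → x ⋖ z → SatChain z y l → SatChain x y (x ∷ l)

  -- one diamond move (Diamond is symmetric in a, b, so this covers
  -- both directions "or vice versa")
  data Move : List A → List A → Set where
    here  : ∀ {x a b y rest} → Diamond x a b y →
            Move (x ∷ a ∷ y ∷ rest) (x ∷ b ∷ y ∷ rest)
    there : ∀ {z l l′} → Move l l′ → Move (z ∷ l) (z ∷ l′)

  DiamondTransitive : Set
  DiamondTransitive = ∀ x y (c c′ : List A) →
    SatChain x y c → SatChain x y c′ → Star Move c c′

record FinBoundedPoset : Set₁ where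
  field
    Carrier        : Set
    _≤_            : Carrier → Carrier → Set
    isPartialOrder : IsPartialOrder _≡_ _≤_
    finite         : Σ ℕ λ m → Carrier ↔ Fin m
    0̂              : Carrier
    1̂              : Carrier
    0̂-least        : ∀ x → 0̂ ≤ x
    1̂-greatest     : ∀ x → x ≤ 1̂

module _ (P Q : FinBoundedPoset) where
  private
    module P = FinBoundedPoset P
    module Q = FinBoundedPoset Q

  -- (P ∖ {0̂,1̂}) ⊔ (Q ∖ {0̂,1̂}) ⊔ {0̂,1̂}
  -- (the proofs of non-extremality are irrelevant, so elements are
  -- determined by the underlying element of P resp. Q)
  data Pinch : Set where
    bot : Pinch
    top : Pinch
    inP : (x : P.Carrier) → .(x ≢ P.0̂) → .(x ≢ P.1̂) → Pinch
    inQ : (x : Q.Carrier) → .(x ≢ Q.0̂) → .(x ≢ Q.1̂) → Pinch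

  _≤⋈_ : Pinch → Pinch → Set
  bot ≤⋈ _ = Unit
  top ≤⋈ top = Unit
  top ≤⋈ _ = Empty
  inP x _ _ ≤⋈ top = Unit
  inP x _ _ ≤⋈ inP y _ _ = x P.≤ y
  inP x _ _ ≤⋈ _ = Empty
  inQ x _ _ ≤⋈ top = Unit
  inQ x _ _ ≤⋈ inQ y _ _ = x Q.≤ y
  inQ x _ _ ≤⋈ _ = Empty

module Submission where

-- The pinch P ⋈ Q is covered by the two images of the order embeddings
-- embed s : Factor s → P ⋈ Q (s = true for P, s = false for Q) sending
-- 0̂ ↦ bot, 1̂ ↦ top and every other element to itself.  Every comparable
-- pair u ⊑ v lies in one of these images, and except for the pair (bot, top)
-- the image contains the whole interval [u, v].  Since rank n ≥ 3, covers and
-- intervals of length 2 never span from bot to top, so rank and thinness of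
-- the pinch are read off from the factors.
--
-- For non-transitivity, a diamond of the pinch never spans bot..top either,
-- so a diamond move replaces an interior element of P by another interior
-- element of P.  Hence "the chain meets P ∖ {0̂, 1̂}" is invariant under diamond
-- moves; the image of a maximal chain of P has this property and the image of
-- a maximal chain of Q does not.  Maximal chains exist classically in finite
-- posets; since the goal is a negation, double negation suffices.

open import Defs
open import Level using (0ℓ)
open import Data.Bool using (Bool; true; false)
open import Data.Nat as ℕ using (ℕ; zero; suc; _+_; _≤_; s≤s; z≤n)
open import Data.Nat.Properties using (≤-trans; <-irrefl; m≤m+n; +-suc; +-identityʳ)
open import Data.Fin as Fin using (Fin)
open import Data.Fin.Properties using (injective⇒≤) renaming (_≟_ to _≟Fin_)
open import Data.List using (List; map)
open import Data.List.Properties using (length-map)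
open import Data.List.Membership.Propositional using (_∈_)
open import Data.List.Membership.Propositional.Properties using (∈-map⁺; ∈-map⁻)
open import Data.List.Relation.Unary.Any as Any using (Any; satisfied)
open import Data.List.Relation.Unary.Any.Properties using (map⁻)
open import Data.List.Relation.Unary.Unique.Propositional.Properties using () renaming (map⁺ to unique-map⁺)
open import Data.Product using (Σ; ∃; _×_; _,_; proj₁; proj₂)
open import Data.Sum using (_⊎_; inj₁; inj₂)
open import Data.Empty using (⊥; ⊥-elim; ⊥-elim-irr)
open import Data.Unit using (tt)
open import Effect.Monad using (RawMonad)
open import Function using (id; _∘_)
open import Function.Bundles using (_↔_; mk⇔; Equivalence; Injection)
open import Function.Definitions using (Injective)
open import Function.Properties.Inverse using (↔⇒↣)
open import Relation.Binary.Construct.Closure.ReflexiveTransitive using (Star; ε; _◅_)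
open import Relation.Binary.Definitions using (Reflexive; Antisymmetric; DecidableEquality)
open import Relation.Binary.PropositionalEquality
open import Relation.Binary.Structures using (IsPartialOrder)
open import Relation.Nullary using (¬_; yes; no)
open import Relation.Nullary.Decidable using (via-injection; ¬¬-excluded-middle)
open import Relation.Nullary.Negation using (¬¬-Monad)

-- Classically: a strict chain from x to y that is not saturated can be
-- lengthened, and strict chains have at most m vertices.
module FiniteChains {A : Set} {_≤_ : A → A → Set} (isPO : IsPartialOrder _≡_ _≤_)
                    {m : ℕ} (enumeration : A ↔ Fin m) where
  open Order _≤_
  open IsPartialOrder isPO using (antisym) renaming (refl to ≤-refl; trans to ≤-trans′)
  open RawMonad (¬¬-Monad {0ℓ})

  HasSatChain : A → A → Set
  HasSatChain x y = Σ (List A) λ l → SatChain x y l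

  data StrictChain : A → A → ℕ → Set where
    done  : ∀ {x} → StrictChain x x 0
    _∷<_ : ∀ {x z y L} → x < z → StrictChain z y L → StrictChain x y (suc L)

  vertex : ∀ {x y L} → StrictChain x y L → Fin (suc L) → A
  vertex {x} _ Fin.zero = x
  vertex (_ ∷< c) (Fin.suc i) = vertex c i

  start≤vertex : ∀ {x y L} (c : StrictChain x y L) i → x ≤ vertex c i
  start≤vertex _ Fin.zero = ≤-refl
  start≤vertex ((x≤z , _) ∷< c) (Fin.suc i) = ≤-trans′ x≤z (start≤vertex c i)

  start-fresh : ∀ {x z y L} → x < z → (c : StrictChain z y L) → ∀ j → x ≢ vertex c j
  start-fresh (x≤z , x≢z) c j refl = x≢z (antisym x≤z (start≤vertex c j))

  vertex-injective : ∀ {x y L} (c : StrictChain x y L) → Injective _≡_ _≡_ (vertex c)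
  vertex-injective c {Fin.zero} {Fin.zero} _ = refl
  vertex-injective (x<z ∷< c) {Fin.zero} {Fin.suc j} e = ⊥-elim (start-fresh x<z c j e)
  vertex-injective (x<z ∷< c) {Fin.suc i} {Fin.zero} e = ⊥-elim (start-fresh x<z c i (sym e))
  vertex-injective (_ ∷< c) {Fin.suc i} {Fin.suc j} e = cong Fin.suc (vertex-injective c e)

  length-bound : ∀ {x y L} → StrictChain x y L → suc L ℕ.≤ m
  length-bound c = injective⇒≤ (vertex-injective c ∘ Injection.injective (↔⇒↣ enumeration))

  split : ∀ {x z} → x < z → ¬ (x ⋖ z) → ¬ ¬ (∃ λ w → x < w × w < z)
  split x<z x⋪z no-w = x⋪z (x<z , λ w x<w w<z → no-w (w , x<w , w<z))

  refine : ∀ {x y L} → StrictChain x y L → ¬ ¬ (HasSatChain x y ⊎ StrictChain x y (suc L))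
  refine done = pure (inj₁ (_ , single))
  refine (_∷<_ {x} {z} x<z c) = do
    inj₁ (_ , sat) ← refine c
      where inj₂ c′ → pure (inj₂ (x<z ∷< c′))
    yes x⋖z ← ¬¬-excluded-middle {A = x ⋖ z}
      where no x⋪z → do
              (w , x<w , w<z) ← split x<z x⋪z
              pure (inj₂ (x<w ∷< (w<z ∷< c)))
    pure (inj₁ (_ , step x⋖z sat))

  -- refining k more times must produce a saturated chain once k + L ≥ m
  satChain-from : ∀ k {x y L} → StrictChain x y L → m ℕ.≤ k + L → ¬ ¬ HasSatChain x y
  satChain-from zero c m≤L _ = <-irrefl refl (≤-trans (length-bound c) m≤L)
  satChain-from (suc k) {L = L} c m≤ = do
    inj₂ c′ ← refine c
      where inj₁ sat → pure sat
    satChain-from k c′ (subst (m ℕ.≤_) (sym (+-suc k L)) m≤)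

  satChain : ∀ {x y} → x ≤ y → ¬ ¬ HasSatChain x y
  satChain {x} {y} x≤y = do
    no x≢y ← ¬¬-excluded-middle {A = x ≡ y}
      where yes refl → pure (_ , single)
    satChain-from m ((x≤y , x≢y) ∷< done) (m≤m+n m 1)

module OrderEmbedding {A B : Set} {_≤A_ : A → A → Set} {_≤B_ : B → B → Set}
    (antisymA : Antisymmetric _≡_ _≤A_) (reflB : Reflexive _≤B_) (f : A → B)
    (mono : ∀ {x y} → x ≤A y → f x ≤B f y) (reflect : ∀ {x y} → f x ≤B f y → x ≤A y) where
  module OA = Order _≤A_
  module OB = Order _≤B_

  injective : ∀ {x y} → f x ≡ f y → x ≡ y
  injective {x} e = antisymA (reflect (subst (f x ≤B_) e reflB)) (reflect (subst (_≤B f x) e reflB))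

  <-preserve : ∀ {x y} → x OA.< y → f x OB.< f y
  <-preserve (x≤y , x≢y) = mono x≤y , x≢y ∘ injective

  <-reflect : ∀ {x y} → f x OB.< f y → x OA.< y
  <-reflect (fx≤fy , fx≢fy) = reflect fx≤fy , fx≢fy ∘ cong f

  ⋖-reflect : ∀ {a b} → f a OB.⋖ f b → a OA.⋖ b
  ⋖-reflect (fa<fb , nothing-between) =
    <-reflect fa<fb , λ z a<z z<b → nothing-between (f z) (<-preserve a<z) (<-preserve z<b)

  Convex : A → A → Set
  Convex a b = ∀ w → f a ≤B w → w ≤B f b → Σ A λ z → f z ≡ w

  ⋖-preserve : ∀ {a b} → a OA.⋖ b → Convex a b → f a OB.⋖ f b
  ⋖-preserve {a} {b} (a<b , nothing-between) convex = <-preserve a<b , between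
    where
    between : ∀ w → f a OB.< w → w OB.< f b → ⊥
    between w fa<w w<fb with convex w (proj₁ fa<w) (proj₁ w<fb)
    ... | z , refl = nothing-between z (<-reflect fa<w) (<-reflect w<fb)

  four-preserve : ∀ {a b} → OA.HasFourElements (OA.Interval a b) → Convex a b →
                  OB.HasFourElements (OB.Interval (f a) (f b))
  four-preserve {a} {b} (xs , four , unique , members) convex =
    map f xs , trans (length-map f xs) four , unique-map⁺ injective unique ,
    λ w → mk⇔ (into w) (outof w)
    where
    into : ∀ w → OB.Interval (f a) (f b) w → w ∈ map f xs
    into w (fa≤w , w≤fb) with convex w fa≤w w≤fb
    ... | z , refl = ∈-map⁺ f (Equivalence.to (members z) (reflect fa≤w , reflect w≤fb))
    outof : ∀ w → w ∈ map f xs → OB.Interval (f a) (f b) w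
    outof w w∈ with ∈-map⁻ f w∈
    ... | z , z∈xs , refl with Equivalence.from (members z) z∈xs
    ...   | a≤z , z≤b = mono a≤z , mono z≤b

  satChain-preserve : (∀ {x y} → x OA.⋖ y → f x OB.⋖ f y) →
                      ∀ {a b l} → OA.SatChain a b l → OB.SatChain (f a) (f b) (map f l)
  satChain-preserve covers OA.single = OB.single
  satChain-preserve covers (OA.step a⋖z c) = OB.step (covers a⋖z) (satChain-preserve covers c)

module PinchProduct (P Q : FinBoundedPoset) where

  _⊑_ : Pinch P Q → Pinch P Q → Set
  _⊑_ = _≤⋈_ P Q

  open Order _⊑_

  Factor : Bool → FinBoundedPoset
  Factor true = P
  Factor false = Q

  module F (s : Bool) = FinBoundedPoset (Factor s)
  module FO (s : Bool) = IsPartialOrder (F.isPartialOrder s)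
  module FOrd (s : Bool) = Order (F._≤_ s)
  open F using (Carrier; 0̂; 1̂)

  ⊑-refl : Reflexive _⊑_
  ⊑-refl {bot} = tt
  ⊑-refl {top} = tt
  ⊑-refl {inP _ _ _} = FO.refl true
  ⊑-refl {inQ _ _ _} = FO.refl false

  ⊑-trans : ∀ {x y z} → x ⊑ y → y ⊑ z → x ⊑ z
  ⊑-trans {bot} _ _ = tt
  ⊑-trans {top} {top} {top} _ _ = tt
  ⊑-trans {inP _ _ _} {top} {top} _ _ = tt
  ⊑-trans {inP _ _ _} {inP _ _ _} {top} _ _ = tt
  ⊑-trans {inP _ _ _} {inP _ _ _} {inP _ _ _} p q = FO.trans true p q
  ⊑-trans {inQ _ _ _} {top} {top} _ _ = tt
  ⊑-trans {inQ _ _ _} {inQ _ _ _} {top} _ _ = tt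
  ⊑-trans {inQ _ _ _} {inQ _ _ _} {inQ _ _ _} p q = FO.trans false p q

  ⊑-antisym : ∀ {x y} → x ⊑ y → y ⊑ x → x ≡ y
  ⊑-antisym {bot} {bot} _ _ = refl
  ⊑-antisym {top} {top} _ _ = refl
  ⊑-antisym {inP _ _ _} {inP _ _ _} p q with FO.antisym true p q
  ... | refl = refl
  ⊑-antisym {inQ _ _ _} {inQ _ _ _} p q with FO.antisym false p q
  ... | refl = refl

  ⊑-isPartialOrder : IsPartialOrder _≡_ _⊑_
  ⊑-isPartialOrder = record
    { isPreorder = record
      { isEquivalence = isEquivalence
      ; reflexive = λ { {x} refl → ⊑-refl {x} }
      ; trans = λ {x} {y} {z} → ⊑-trans {x} {y} {z} }
    ; antisym = ⊑-antisym }

  inside : ∀ s (x : Carrier s) → .(x ≢ 0̂ s) → .(x ≢ 1̂ s) → Pinch P Q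
  inside true = inP
  inside false = inQ

  InSide : Bool → Pinch P Q → Set
  InSide s bot = ⊥
  InSide s top = ⊥
  InSide s (inP _ _ _) = s ≡ true
  InSide s (inQ _ _ _) = s ≡ false

  inside-in-side : ∀ s {x} .{p q} → InSide s (inside s x p q)
  inside-in-side true = refl
  inside-in-side false = refl

  inside-side : ∀ s {s′ x} .{p q} → InSide s′ (inside s x p q) → s′ ≡ s
  inside-side true = id
  inside-side false = id

  inside-mono : ∀ s {x y} .{p q p′ q′} → F._≤_ s x y → inside s x p q ⊑ inside s y p′ q′
  inside-mono true = id
  inside-mono false = id

  inside-reflect : ∀ s {x y} .{p q p′ q′} → inside s x p q ⊑ inside s y p′ q′ → F._≤_ s x y
  inside-reflect true = id
  inside-reflect false = id

  inside⊑top : ∀ s {x} .{p q} → inside s x p q ⊑ top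
  inside⊑top true = tt
  inside⊑top false = tt

  top⋢inside : ∀ s {x} .{p q} → ¬ (top ⊑ inside s x p q)
  top⋢inside true ()
  top⋢inside false ()

  inside⋢bot : ∀ s {x} .{p q} → ¬ (inside s x p q ⊑ bot)
  inside⋢bot true ()
  inside⋢bot false ()

  below-bot : ∀ {u} → u ⊑ bot → u ≡ bot
  below-bot {bot} _ = refl

  above-top : ∀ {v} → top ⊑ v → v ≡ top
  above-top {top} _ = refl

  below-side : ∀ {s u w} → u ⊑ w → InSide s w → u ≡ bot ⊎ InSide s u
  below-side {u = bot} _ _ = inj₁ refl
  below-side {u = top} {top} _ ()
  below-side {u = inP _ _ _} {inP _ _ _} _ w∈s = inj₂ w∈s
  below-side {u = inQ _ _ _} {inQ _ _ _} _ w∈s = inj₂ w∈s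

  above-side : ∀ {s w v} → w ⊑ v → InSide s w → v ≡ top ⊎ InSide s v
  above-side {w = inP _ _ _} {top} _ _ = inj₁ refl
  above-side {w = inP _ _ _} {inP _ _ _} _ w∈s = inj₂ w∈s
  above-side {w = inQ _ _ _} {top} _ _ = inj₁ refl
  above-side {w = inQ _ _ _} {inQ _ _ _} _ w∈s = inj₂ w∈s

  endpoint-side : ∀ {s x a y} → x ⊑ a → a ⊑ y → InSide s a → ¬ (x ≡ bot × y ≡ top) →
                  InSide s x ⊎ InSide s y
  endpoint-side x⊑a a⊑y a∈s spans with below-side x⊑a a∈s | above-side a⊑y a∈s
  ... | inj₂ x∈s | _ = inj₁ x∈s
  ... | inj₁ _ | inj₂ y∈s = inj₂ y∈s
  ... | inj₁ x≡bot | inj₁ y≡top = ⊥-elim (spans (x≡bot , y≡top))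

  between-side : ∀ {s x b y} → x < b → b < y → InSide s x ⊎ InSide s y → InSide s b
  between-side (x⊑b , _) (b⊑y , b≢y) (inj₁ x∈s) with above-side x⊑b x∈s
  ... | inj₂ b∈s = b∈s
  ... | inj₁ refl = ⊥-elim (b≢y (sym (above-top b⊑y)))
  between-side (x⊑b , x≢b) (b⊑y , _) (inj₂ y∈s) with below-side b⊑y y∈s
  ... | inj₂ b∈s = b∈s
  ... | inj₁ refl = ⊥-elim (x≢b (below-bot x⊑b))

  module Embedding (distinct : ∀ s → 0̂ s ≢ 1̂ s) where

    data Position (s : Bool) (x : Carrier s) : Set where
      at0̂      : x ≡ 0̂ s → Position s x
      at1̂      : x ≡ 1̂ s → Position s x
      interior : x ≢ 0̂ s → x ≢ 1̂ s → Position s x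

    -- finite factors have decidable equality
    position : ∀ s x → Position s x
    position s x with _≟_ x (0̂ s) | _≟_ x (1̂ s)
      where
      _≟_ : DecidableEquality (Carrier s)
      _≟_ = via-injection (↔⇒↣ (proj₂ (F.finite s))) _≟Fin_
    ... | yes x≡0̂ | _ = at0̂ x≡0̂
    ... | no _ | yes x≡1̂ = at1̂ x≡1̂
    ... | no x≢0̂ | no x≢1̂ = interior x≢0̂ x≢1̂

    -- the embedding, defined on an element together with its position;
    -- lemmas about embed are proved for an arbitrary position
    embedAt : ∀ s {x} → Position s x → Pinch P Q
    embedAt s (at0̂ _) = bot
    embedAt s (at1̂ _) = top
    embedAt s {x} (interior x≢0̂ x≢1̂) = inside s x x≢0̂ x≢1̂

    embed : ∀ s → Carrier s → Pinch P Q
    embed s x = embedAt s (position s x)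

    embed-0̂ : ∀ s → embed s (0̂ s) ≡ bot
    embed-0̂ s = at (position s (0̂ s))
      where
      at : (p : Position s (0̂ s)) → embedAt s p ≡ bot
      at (at0̂ _) = refl
      at (at1̂ 0̂≡1̂) = ⊥-elim (distinct s 0̂≡1̂)
      at (interior 0̂≢0̂ _) = ⊥-elim (0̂≢0̂ refl)

    embed-1̂ : ∀ s → embed s (1̂ s) ≡ top
    embed-1̂ s = at (position s (1̂ s))
      where
      at : (p : Position s (1̂ s)) → embedAt s p ≡ top
      at (at0̂ 1̂≡0̂) = ⊥-elim (distinct s (sym 1̂≡0̂))
      at (at1̂ _) = refl
      at (interior _ 1̂≢1̂) = ⊥-elim (1̂≢1̂ refl)

    embed-inside : ∀ s x .(p : x ≢ 0̂ s) .(q : x ≢ 1̂ s) → embed s x ≡ inside s x p q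
    embed-inside s x p q = at (position s x)
      where
      at : (px : Position s x) → embedAt s px ≡ inside s x p q
      at (at0̂ x≡0̂) = ⊥-elim-irr (p x≡0̂)
      at (at1̂ x≡1̂) = ⊥-elim-irr (q x≡1̂)
      at (interior _ _) = refl

    embed-mono : ∀ s {x y} → F._≤_ s x y → embed s x ⊑ embed s y
    embed-mono s = at (position s _) (position s _)
      where
      at : ∀ {x y} (px : Position s x) (py : Position s y) → F._≤_ s x y → embedAt s px ⊑ embedAt s py
      at (at0̂ _) _ _ = tt
      at (at1̂ _) (at1̂ _) _ = tt
      at (interior _ _) (at1̂ _) _ = inside⊑top s
      at (interior _ _) (interior _ _) x≤y = inside-mono s x≤y
      at (at1̂ refl) (at0̂ refl) 1̂≤0̂ = ⊥-elim (distinct s (FO.antisym s (F.0̂-least s _) 1̂≤0̂))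
      at (at1̂ refl) (interior _ y≢1̂) 1̂≤y = ⊥-elim (y≢1̂ (FO.antisym s (F.1̂-greatest s _) 1̂≤y))
      at (interior x≢0̂ _) (at0̂ refl) x≤0̂ = ⊥-elim (x≢0̂ (FO.antisym s x≤0̂ (F.0̂-least s _)))

    embed-reflect : ∀ s {x y} → embed s x ⊑ embed s y → F._≤_ s x y
    embed-reflect s = at (position s _) (position s _)
      where
      at : ∀ {x y} (px : Position s x) (py : Position s y) → embedAt s px ⊑ embedAt s py → F._≤_ s x y
      at (at0̂ refl) _ _ = F.0̂-least s _
      at _ (at1̂ refl) _ = F.1̂-greatest s _
      at (at1̂ _) (at0̂ _) ()
      at (at1̂ _) (interior _ _) top⊑y = ⊥-elim (top⋢inside s top⊑y)
      at (interior _ _) (at0̂ _) x⊑bot = ⊥-elim (inside⋢bot s x⊑bot)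
      at (interior _ _) (interior _ _) x⊑y = inside-reflect s x⊑y

    embed-side : ∀ s {s′ x} → InSide s′ (embed s x) → s′ ≡ s
    embed-side s = at (position s _)
      where
      at : ∀ {s′ x} (px : Position s x) → InSide s′ (embedAt s px) → s′ ≡ s
      at (at0̂ _) ()
      at (at1̂ _) ()
      at (interior _ _) = inside-side s

    embed-interior : ∀ s {x} → x ≢ 0̂ s → x ≢ 1̂ s → InSide s (embed s x)
    embed-interior s {x} p q = subst (InSide s) (sym (embed-inside s x p q)) (inside-in-side s)

    module Emb (s : Bool) =
      OrderEmbedding {_≤A_ = F._≤_ s} {_≤B_ = _⊑_} (FO.antisym s) (λ {w} → ⊑-refl {w}) (embed s) (embed-mono s) (embed-reflect s)

    Preimage : Bool → Pinch P Q → Set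
    Preimage s w = Σ (Carrier s) λ z → embed s z ≡ w

    below-foreign : ∀ s {s′ a w} → s′ ≢ s → InSide s′ w → embed s a ⊑ w → embed s a ≡ bot
    below-foreign s s′≢s w∈s′ a⊑w with below-side a⊑w w∈s′
    ... | inj₁ a≡bot = a≡bot
    ... | inj₂ a∈s′ = ⊥-elim (s′≢s (embed-side s a∈s′))

    above-foreign : ∀ s {s′ b w} → s′ ≢ s → InSide s′ w → w ⊑ embed s b → embed s b ≡ top
    above-foreign s s′≢s w∈s′ w⊑b with above-side w⊑b w∈s′
    ... | inj₁ b≡top = b≡top
    ... | inj₂ b∈s′ = ⊥-elim (s′≢s (embed-side s b∈s′))

    convex : ∀ s {a b} → ¬ (embed s a ≡ bot × embed s b ≡ top) → Emb.Convex s a b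
    convex s _ bot _ _ = 0̂ s , embed-0̂ s
    convex s _ top _ _ = 1̂ s , embed-1̂ s
    convex true _ (inP z p q) _ _ = z , embed-inside true z p q
    convex false _ (inQ z p q) _ _ = z , embed-inside false z p q
    convex true spans w@(inQ _ _ _) a⊑w w⊑b = ⊥-elim (spans
      (below-foreign true {w = w} (λ ()) refl a⊑w , above-foreign true {w = w} (λ ()) refl w⊑b))
    convex false spans w@(inP _ _ _) a⊑w w⊑b = ⊥-elim (spans
      (below-foreign false {w = w} (λ ()) refl a⊑w , above-foreign false {w = w} (λ ()) refl w⊑b))

    pair-in-factor : ∀ u v → u ⊑ v → Σ Bool λ s → Preimage s u × Preimage s v
    pair-in-factor bot bot _ = true , (0̂ true , embed-0̂ true) , (0̂ true , embed-0̂ true)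
    pair-in-factor bot top _ = true , (0̂ true , embed-0̂ true) , (1̂ true , embed-1̂ true)
    pair-in-factor bot (inP y p q) _ = true , (0̂ true , embed-0̂ true) , (y , embed-inside true y p q)
    pair-in-factor bot (inQ y p q) _ = false , (0̂ false , embed-0̂ false) , (y , embed-inside false y p q)
    pair-in-factor top top _ = true , (1̂ true , embed-1̂ true) , (1̂ true , embed-1̂ true)
    pair-in-factor (inP x p q) top _ = true , (x , embed-inside true x p q) , (1̂ true , embed-1̂ true)
    pair-in-factor (inP x p q) (inP y p′ q′) _ =
      true , (x , embed-inside true x p q) , (y , embed-inside true y p′ q′)
    pair-in-factor (inQ x p q) top _ = false , (x , embed-inside false x p q) , (1̂ false , embed-1̂ false)
    pair-in-factor (inQ x p q) (inQ y p′ q′) _ =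
      false , (x , embed-inside false x p q) , (y , embed-inside false y p′ q′)

  module Graded (n : ℕ) (3≤n : 3 ≤ n) (rank : ∀ s → Carrier s → ℕ)
      (thin : ∀ s → Order.IsThin (F._≤_ s) (rank s))
      (rank-0̂ : ∀ s → rank s (0̂ s) ≡ 0) (rank-1̂ : ∀ s → rank s (1̂ s) ≡ n) where

    -- the top has rank n ≥ 3 > 1, so 0̂ ≠ 1̂ and 1̂ does not cover 0̂
    1<n : 1 ℕ.< n
    1<n = ≤-trans (s≤s (s≤s z≤n)) 3≤n

    distinct : ∀ s → 0̂ s ≢ 1̂ s
    distinct s 0̂≡1̂ = <-irrefl (trans (sym (rank-0̂ s)) (trans (cong (rank s) 0̂≡1̂) (rank-1̂ s)))
                              (≤-trans (s≤s z≤n) 1<n)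

    open Embedding distinct

    rk : Pinch P Q → ℕ
    rk bot = 0
    rk top = n
    rk (inP x _ _) = rank true x
    rk (inQ x _ _) = rank false x

    rk-inside : ∀ s {x} .{p q} → rk (inside s x p q) ≡ rank s x
    rk-inside true = refl
    rk-inside false = refl

    rk-embed : ∀ s x → rk (embed s x) ≡ rank s x
    rk-embed s x = at (position s x)
      where
      at : ∀ {x} (px : Position s x) → rk (embedAt s px) ≡ rank s x
      at (at0̂ refl) = sym (rank-0̂ s)
      at (at1̂ refl) = sym (rank-1̂ s)
      at (interior _ _) = rk-inside s

    rank-step-to-pinch : ∀ s {a b} k → rank s b ≡ k + rank s a → rk (embed s b) ≡ k + rk (embed s a)
    rank-step-to-pinch s {a} {b} k shift = begin
      rk (embed s b)     ≡⟨ rk-embed s b ⟩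
      rank s b           ≡⟨ shift ⟩
      k + rank s a       ≡⟨ cong (k +_) (rk-embed s a) ⟨
      k + rk (embed s a) ∎
      where open ≡-Reasoning

    rank-step-from-pinch : ∀ s {a b} k → rk (embed s b) ≡ k + rk (embed s a) → rank s b ≡ k + rank s a
    rank-step-from-pinch s {a} {b} k shift = begin
      rank s b           ≡⟨ rk-embed s b ⟨
      rk (embed s b)     ≡⟨ shift ⟩
      k + rk (embed s a) ≡⟨ cong (k +_) (rk-embed s a) ⟩
      k + rank s a       ∎
      where open ≡-Reasoning

    not-spanning : ∀ {u v} k → k ℕ.< n → rk v ≡ k + rk u → ¬ (u ≡ bot × v ≡ top)
    not-spanning k k<n n≡k+0 (refl , refl) = <-irrefl (sym (trans n≡k+0 (+-identityʳ k))) k<n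

    -- covers of a factor stay covers in the pinch, since they do not span bot..top
    embed-covers : ∀ s {a b} → FOrd._⋖_ s a b → embed s a ⋖ embed s b
    embed-covers s {a} {b} a⋖b = Emb.⋖-preserve s a⋖b (convex s (not-spanning 1 1<n
      (rank-step-to-pinch s 1 (proj₁ (thin s) a b a⋖b))))

    -- a cover of the pinch is a cover of one factor, where rank rises by one
    rk-covers : IsRankFunction rk
    rk-covers u v u⋖v with pair-in-factor u v (proj₁ (proj₁ u⋖v))
    ... | s , (a , refl) , (b , refl) =
      rank-step-to-pinch s 1 (proj₁ (thin s) a b (Emb.⋖-reflect s u⋖v))

    -- an interval of length 2 comes from a four-element interval of one factor
    rk-intervals : ∀ u v → u ⊑ v → rk v ≡ 2 + rk u → HasFourElements (Interval u v)
    rk-intervals u v u⊑v rank-two with pair-in-factor u v u⊑v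
    ... | s , (a , refl) , (b , refl) = Emb.four-preserve s
      (proj₂ (thin s) a b (embed-reflect s u⊑v) (rank-step-from-pinch s 2 rank-two))
      (convex s (not-spanning 2 3≤n rank-two))

    rk-thin : IsThin rk
    rk-thin = rk-covers , rk-intervals

    diamond-side : ∀ {s x a b y} → Diamond x a b y → InSide s a → InSide s b
    diamond-side {x = x} {a} {b} {y} (x⋖a , a⋖y , x⋖b , b⋖y , _) a∈s =
      between-side (proj₁ x⋖b) (proj₁ b⋖y)
        (endpoint-side (proj₁ (proj₁ x⋖a)) (proj₁ (proj₁ a⋖y)) a∈s (not-spanning 2 3≤n rank-two))
      where
      rank-two : rk y ≡ 2 + rk x
      rank-two = trans (rk-covers a y a⋖y) (cong suc (rk-covers x a x⋖a))

    move-side : ∀ {s l l′} → Move l l′ → Any (InSide s) l → Any (InSide s) l′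
    move-side (here _) (Any.here x∈s) = Any.here x∈s
    move-side (here d) (Any.there (Any.here a∈s)) = Any.there (Any.here (diamond-side d a∈s))
    move-side (here _) (Any.there (Any.there r)) = Any.there (Any.there r)
    move-side (there _) (Any.here z∈s) = Any.here z∈s
    move-side (there m) (Any.there r) = Any.there (move-side m r)

    moves-side : ∀ {s l l′} → Star Move l l′ → Any (InSide s) l → Any (InSide s) l′
    moves-side ε = id
    moves-side (m ◅ ms) = moves-side ms ∘ move-side m

    chain-to-pinch : ∀ s {l} → FOrd.SatChain s (0̂ s) (1̂ s) l → SatChain bot top (map (embed s) l)
    chain-to-pinch s {l} c = subst₂ (λ u v → SatChain u v (map (embed s) l)) (embed-0̂ s) (embed-1̂ s)
      (Emb.satChain-preserve s (embed-covers s) c)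

    -- an atom of a factor is interior, since n ≠ 1
    atom-side : ∀ s {z} → FOrd._⋖_ s (0̂ s) z → InSide s (embed s z)
    atom-side s {z} 0̂⋖z = embed-interior s (λ z≡0̂ → proj₂ (proj₁ 0̂⋖z) (sym z≡0̂)) z≢1̂
      where
      z≢1̂ : z ≢ 1̂ s
      z≢1̂ refl = <-irrefl (trans (cong suc (sym (rank-0̂ s))) (trans (sym (proj₁ (thin s) _ _ 0̂⋖z)) (rank-1̂ s))) 1<n

    -- a maximal chain of factor s meets its interior at its second vertex
    chain-meets-side : ∀ s {x y l} → FOrd.SatChain s x y l → x ≡ 0̂ s → y ≡ 1̂ s →
                       Any (InSide s) (map (embed s) l)
    chain-meets-side s FOrd.single refl x≡1̂ = ⊥-elim (distinct s x≡1̂)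
    chain-meets-side s (FOrd.step 0̂⋖z FOrd.single) refl _ = Any.there (Any.here (atom-side s 0̂⋖z))
    chain-meets-side s (FOrd.step 0̂⋖z (FOrd.step _ _)) refl _ = Any.there (Any.here (atom-side s 0̂⋖z))

    chain-avoids-side : ∀ s {s′ l} → Any (InSide s′) (map (embed s) l) → s′ ≡ s
    chain-avoids-side s = embed-side s ∘ proj₂ ∘ satisfied ∘ map⁻

    module Chains (s : Bool) = FiniteChains (F.isPartialOrder s) (proj₂ (F.finite s))

    not-diamond-transitive : ¬ DiamondTransitive
    not-diamond-transitive transitive =
      Chains.satChain true (F.0̂-least true _) λ (_ , chainP) →
      Chains.satChain false (F.0̂-least false _) λ (_ , chainQ) →
      true≢false (chain-avoids-side false
        (moves-side (transitive bot top _ _ (chain-to-pinch true chainP) (chain-to-pinch false chainQ))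
                    (chain-meets-side true chainP refl refl)))
      where
      true≢false : true ≢ false
      true≢false ()

mainTheorem14 : (P Q : FinBoundedPoset) (n : ℕ) → 3 ≤ n →
    (rkP : FinBoundedPoset.Carrier P → ℕ) →
    Order.IsThin (FinBoundedPoset._≤_ P) rkP →
    rkP (FinBoundedPoset.0̂ P) ≡ 0 → rkP (FinBoundedPoset.1̂ P) ≡ n →
    (rkQ : FinBoundedPoset.Carrier Q → ℕ) →
    Order.IsThin (FinBoundedPoset._≤_ Q) rkQ →
    rkQ (FinBoundedPoset.0̂ Q) ≡ 0 → rkQ (FinBoundedPoset.1̂ Q) ≡ n →
    IsPartialOrder _≡_ (_≤⋈_ P Q)
      × Σ (Pinch P Q → ℕ) (λ rk → Order.IsThin (_≤⋈_ P Q) rk)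
      × ¬ Order.DiamondTransitive (_≤⋈_ P Q)
mainTheorem14 P Q n 3≤n rkP thinP rkP-0̂ rkP-1̂ rkQ thinQ rkQ-0̂ rkQ-1̂ =
  ⊑-isPartialOrder , (rk , rk-thin) , not-diamond-transitive
  where
  open PinchProduct P Q
  rank : ∀ s → F.Carrier s → ℕ
  rank true = rkP
  rank false = rkQ
  thin : ∀ s → Order.IsThin (F._≤_ s) (rank s)
  thin true = thinP
  thin false = thinQ
  rank-0̂ : ∀ s → rank s (F.0̂ s) ≡ 0
  rank-0̂ true = rkP-0̂
  rank-0̂ false = rkQ-0̂
  rank-1̂ : ∀ s → rank s (F.1̂ s) ≡ n
  rank-1̂ true = rkP-1̂
  rank-1̂ false = rkQ-1̂
  open Graded n 3≤n rank thin rank-0̂ rank-1̂
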